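{- Let $\mathbb{P}$ denote the set of prime numbers. The function $g$ maps the non-negative integers into $\mathbb{N}_{\geq 0} \setminus \mathbb{P}$ and is surjective onto $\mathbb{N}_{\geq 0} \setminus \mathbb{P}$, i.e. every non-negative integer that is not prime equals $g(n)$ for some non-negative integer $n$.
   Context: For a non-negative integer $n$, $g(n)$ is the least integer $k$ such that there exists a strictly increasing sequence of integers $n = a_1 < a_2 < \cdots < a_t = k$ ($t \geq 1$) whose product $a_1 a_2 \cdots a_t$ is a perfect square. -}

module Defs where

open import Data.Nat using (ℕ; _*_; _<_; _≤_)
open import Data.List using (List; _∷_; last)
open import Data.Nat.ListAction using (product)
open import Data.List.Relation.Unary.Linked using (Linked)
open import Data.Maybe using (just)
open import Data.Product using (Σ; ∃; _×_)
open import Relation.Binary.PropositionalEquality using (_≡_)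

IsSquare : ℕ → Set
IsSquare m = ∃ λ r → r * r ≡ m

-- There is a strictly increasing sequence n = a₁ < a₂ < ⋯ < a_t = k (t ≥ 1)
-- whose product is a perfect square. The sequence is n ∷ xs.
Admissible : ℕ → ℕ → Set
Admissible n k =
  Σ (List ℕ) λ xs →
    Linked _<_ (n ∷ xs) × last (n ∷ xs) ≡ just k × IsSquare (product (n ∷ xs))

IsG : ℕ → ℕ → Set
IsG n k = Admissible n k × (∀ j → Admissible n j → k ≤ j)

-- g(n) exists since n · 4n = (2n)², and it is never prime: for n ≥ 1 the last term k of an
-- admissible sequence exceeds every other term, so a prime k would divide the square product
-- exactly once. Conversely, a non-prime m ≥ 1 ends some admissible sequence with positive start
-- (m alone if m is a square, otherwise a, b, ab for m = ab with 1 < a < b); let n be the largest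
-- such start. If an admissible sequence from n ended at some j < m, then the symmetric difference
-- of the two sequences would have square product, avoid n and end at m, contradicting the
-- maximality of n. Hence g(n) = m.
module Submission where

open import Defs
open import Data.Nat using (ℕ; zero; suc; _+_; _*_; _≤_; _<_; z≤n; s≤s; z<s; NonZero; _≟_; _≤?_; ≢-nonZero; ≢-nonZero⁻¹; >-nonZero; >-nonZero⁻¹; nonTrivial⇒n>1)
open import Data.Nat.Properties
open import Data.Nat.Divisibility using (_∣_; divides; ∣⇒≤; ∣1⇒≡1; m∣m*n; ∣-trans; *-cancelʳ-∣)
open import Data.Nat.DivMod using (_/_; m/n*n≡m)
open import Data.Nat.GCD using (gcd; gcd[m,n]∣m; gcd[m,n]∣n; gcd[m,n]≢0)
open import Data.Nat.Coprimality using (coprime-/gcd; coprime-divisor)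
open import Data.Nat.Primality using (Prime; composite; euclidsLemma; ¬prime[0]; ¬prime[1]; ¬prime⇒composite; prime⇒nonZero)
open import Data.Nat.Induction using (<-rec)
open import Data.Nat.ListAction using (product)
open import Data.Nat.Tactic.RingSolver using (solve-∀)
open import Data.List using (List; []; _∷_; last; foldr)
open import Data.List.Membership.Propositional using (_∈_; _∉_)
open import Data.List.Relation.Unary.Any as Any using (here; there)
open import Data.List.Relation.Unary.All as All using (All; []; _∷_)
open import Data.List.Relation.Unary.Linked as Linked using (Linked; []; [-]; _∷_)
open import Data.List.Relation.Unary.Linked.Properties using (Linked⇒All)
open import Data.Maybe using (just)
open import Data.Product using (Σ; ∃; _×_; _,_)
open import Data.Sum using (_⊎_; inj₁; inj₂; [_,_])
open import Function using (id; _∘_; it)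
open import Relation.Binary using (tri<; tri≈; tri>)
open import Relation.Binary.PropositionalEquality using (_≡_; _≢_; refl; sym; trans; cong; cong₂; subst; subst₂; module ≡-Reasoning)
open import Relation.Nullary using (¬_; Dec; yes; no; contradiction)
open import Relation.Nullary.Decidable using (map′; _×-dec_; _⊎-dec_)
open import Relation.Unary using (Pred; Decidable)

m≤m*m : ∀ m → m ≤ m * m
m≤m*m zero    = z≤n
m≤m*m (suc m) = m≤m*n (suc m) (suc m)

square? : ∀ m → Dec (IsSquare m)
square? m = map′ (λ (r , _ , r²≡m) → r , r²≡m)
                 (λ (r , r²≡m) → r , s≤s (subst (r ≤_) r²≡m (m≤m*m r)) , r²≡m)
                 (anyUpTo? (λ r → r * r ≟ m) (suc m))

*-square : ∀ m n → (m * n) * (m * n) ≡ (m * m) * (n * n)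
*-square m n = [m*n]*[o*p]≡[m*o]*[n*p] m n m n

-- Writing c = c′ g and r = r′ g with g = gcd c r, the cofactors are coprime and c′² ∣ r′², forcing c′ = 1.
∣-cancel-square : ∀ {c r} .{{_ : NonZero c}} → c * c ∣ r * r → c ∣ r
∣-cancel-square {c} {r} c²∣r² = subst (_∣ r) (sym c≡g) (gcd[m,n]∣n c r)
  where
  g = gcd c r
  instance
    g≢0 : NonZero g
    g≢0 = ≢-nonZero (gcd[m,n]≢0 c r (inj₁ (≢-nonZero⁻¹ c)))
  c′ = c / g
  r′ = r / g
  square-split : ∀ {x} → g ∣ x → x * x ≡ (x / g * (x / g)) * (g * g)
  square-split {x} g∣x = trans (cong (λ y → y * y) (sym (m/n*n≡m g∣x))) (*-square (x / g) g)
  c′²∣r′² : c′ * c′ ∣ r′ * r′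
  c′²∣r′² = *-cancelʳ-∣ (g * g) {{m*n≢0 g g}}
              (subst₂ _∣_ (square-split (gcd[m,n]∣m c r)) (square-split (gcd[m,n]∣n c r)) c²∣r²)
  c′∣r′ : c′ ∣ r′
  c′∣r′ = coprime-divisor (coprime-/gcd c r) (∣-trans (m∣m*n c′) c′²∣r′²)
  c′≡1 : c′ ≡ 1
  c′≡1 = ∣1⇒≡1 (coprime-divisor (coprime-/gcd c r) (subst (c′ ∣_) (sym (*-identityʳ r′)) c′∣r′))
  c≡g : c ≡ g
  c≡g = trans (sym (m/n*n≡m (gcd[m,n]∣m c r))) (trans (cong (_* g) c′≡1) (*-identityˡ g))

square-cancel : ∀ {m c r} .{{_ : NonZero c}} → m * (c * c) ≡ r * r → IsSquare m
square-cancel {m} {c} {r} m*c²≡r² with ∣-cancel-square {c} {r} (divides m (sym m*c²≡r²))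
... | divides q refl = q , *-cancelʳ-≡ (q * q) m (c * c) {{m*n≢0 c c}} (trans (sym (*-square q c)) (sym m*c²≡r²))

prime∣square⇒∣ : ∀ {p r} → Prime p → p ∣ r * r → p ∣ r
prime∣square⇒∣ {r = r} pp p∣r² = [ id , id ] (euclidsLemma r r pp p∣r²)

¬square[m*p] : ∀ {m p} → Prime p → ¬ p ∣ m → ¬ IsSquare (m * p)
¬square[m*p] {m} {p} pp p∤m (r , r²≡mp) with prime∣square⇒∣ {r = r} pp (divides m r²≡mp)
... | divides q refl = p∤m (divides (q * q) m≡q²p)
  where
  instance
    p≢0 : NonZero p
    p≢0 = prime⇒nonZero pp
  m≡q²p : m ≡ q * q * p
  m≡q²p = *-cancelʳ-≡ m (q * q * p) p (trans (sym r²≡mp) (regroup q p))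
    where
    regroup : ∀ q p → q * p * (q * p) ≡ q * q * p * p
    regroup = solve-∀

prime∤product : ∀ {p ys} → Prime p → All (λ y → 0 < y × y < p) ys → ¬ p ∣ product ys
prime∤product pp [] p∣1 = ¬prime[1] (subst Prime (∣1⇒≡1 p∣1) pp)
prime∤product {ys = y ∷ ys} pp ((0<y , y<p) ∷ bounds) p∣y*ys with euclidsLemma y (product ys) pp p∣y*ys
... | inj₁ p∣y = <⇒≱ y<p (∣⇒≤ {{>-nonZero 0<y}} p∣y)
... | inj₂ p∣ys = prime∤product pp bounds p∣ys

least : ∀ {ℓ} {P : Pred ℕ ℓ} → Decidable P → ∀ {b} → P b → ∃ λ k → P k × (∀ j → P j → k ≤ j)
least {P = P} P? {b} = <-rec (λ b → P b → ∃ λ k → P k × (∀ j → P j → k ≤ j)) step b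
  where
  step : ∀ b → (∀ {j} → j < b → P j → ∃ λ k → P k × (∀ j → P j → k ≤ j)) →
         P b → ∃ λ k → P k × (∀ j → P j → k ≤ j)
  step b below pb with anyUpTo? P? b
  ... | yes (j , j<b , pj) = below j<b pj
  ... | no ∄j<b            = b , pb , λ j pj → ≮⇒≥ λ j<b → ∄j<b (j , j<b , pj)

greatest : ∀ {ℓ} {Q : Pred ℕ ℓ} → Decidable Q → ∀ m → (∀ j → Q j → j ≤ m) →
           ∀ {a} → Q a → ∃ λ n → Q n × (∀ j → Q j → j ≤ n)
greatest {Q = Q} Q? zero ≤0 {a} qa = 0 , subst Q (n≤0⇒n≡0 (≤0 a qa)) qa , ≤0
greatest {Q = Q} Q? (suc m) ≤1+m qa with Q? (suc m)
... | yes q = suc m , q , ≤1+m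
... | no ¬q = greatest Q? m ≤m qa
  where
  ≤m : ∀ j → Q j → j ≤ m
  ≤m j qj = m<1+n⇒m≤n (≤∧≢⇒< (≤1+m j qj) λ { refl → ¬q qj })

Linked⇒All< : ∀ {x xs} → Linked _<_ (x ∷ xs) → All (x <_) xs
Linked⇒All< [-]         = []
Linked⇒All< (x<y ∷ lnk) = Linked⇒All <-trans x<y lnk

All<⇒Linked : ∀ {x xs} → All (x <_) xs → Linked _<_ xs → Linked _<_ (x ∷ xs)
All<⇒Linked []          _   = [-]
All<⇒Linked (x<y ∷ _)   lnk = x<y ∷ lnk

last⇒∈ : ∀ {A : Set} {xs : List A} {k} → last xs ≡ just k → k ∈ xs
last⇒∈ {xs = x ∷ []}     refl = here refl
last⇒∈ {xs = x ∷ y ∷ ys} eq   = there (last⇒∈ {xs = y ∷ ys} eq)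

last⇒All≤ : ∀ {xs k} → Linked _<_ xs → last xs ≡ just k → All (_≤ k) xs
last⇒All≤ [-]         refl = ≤-refl ∷ []
last⇒All≤ (x<y ∷ lnk) eq   with last⇒All≤ lnk eq
... | y≤k ∷ rest = <⇒≤ (<-≤-trans x<y y≤k) ∷ y≤k ∷ rest

maximum⇒last : ∀ {xs k} → Linked _<_ xs → k ∈ xs → All (_≤ k) xs → last xs ≡ just k
maximum⇒last [-]         (here refl)  _               = refl
maximum⇒last (x<y ∷ _)   (here refl)  (_ ∷ y≤x ∷ _)   = contradiction x<y (≤⇒≯ y≤x)
maximum⇒last (_ ∷ lnk)   (there k∈ys) (_ ∷ ≤k)        = maximum⇒last lnk k∈ys ≤k

product-last : ∀ {x xs k} → Linked _<_ (x ∷ xs) → last (x ∷ xs) ≡ just k →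
               ∃ λ ys → All (λ y → x ≤ y × y < k) ys × product (x ∷ xs) ≡ product ys * k
product-last {x} [-] refl = [] , [] , *-comm x 1
product-last {x} {k = k} (x<y ∷ lnk) eq with product-last lnk eq
... | ys , bounds , prod≡ =
  x ∷ ys , (≤-refl , <-≤-trans x<y (All.head (last⇒All≤ lnk eq))) ∷ All.map raise bounds ,
  trans (cong (x *_) prod≡) (sym (*-assoc x (product ys) k))
  where
  raise : ∀ {z} → _ ≤ z × z < k → x ≤ z × z < k
  raise (y≤z , z<k) = <⇒≤ (<-≤-trans x<y y≤z) , z<k

toggle : ℕ → List ℕ → List ℕ
toggle x []       = x ∷ []
toggle x (z ∷ zs) with <-cmp x z
... | tri< _ _ _ = x ∷ z ∷ zs
... | tri≈ _ _ _ = zs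
... | tri> _ _ _ = z ∷ toggle x zs

infixl 6 _△_

-- For duplicate-free xs this is the symmetric difference, and it is strictly increasing when ys is.
_△_ : List ℕ → List ℕ → List ℕ
xs △ ys = foldr toggle ys xs

toggle-All : ∀ {ℓ} {P : Pred ℕ ℓ} {x zs} → P x → All P zs → All P (toggle x zs)
toggle-All         px []         = px ∷ []
toggle-All {x = x} px (_∷_ {z} pz pzs) with <-cmp x z
... | tri< _ _ _ = px ∷ pz ∷ pzs
... | tri≈ _ _ _ = pzs
... | tri> _ _ _ = pz ∷ toggle-All px pzs

toggle-Linked : ∀ {x zs} → Linked _<_ zs → Linked _<_ (toggle x zs)
toggle-Linked {zs = []}     _   = [-]
toggle-Linked {x} {z ∷ zs} lnk with <-cmp x z
... | tri< x<z _ _ = x<z ∷ lnk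
... | tri≈ _ _ _   = Linked.tail lnk
... | tri> _ _ z<x = All<⇒Linked (toggle-All z<x (Linked⇒All< lnk)) (toggle-Linked (Linked.tail lnk))

toggle-∈ : ∀ {k x zs} → k ≢ x → k ∈ zs → k ∈ toggle x zs
toggle-∈ {x = x} {z ∷ zs} k≢x k∈z∷zs with <-cmp x z | k∈z∷zs
... | tri< _ _ _    | k∈         = there k∈
... | tri≈ _ refl _ | here refl  = contradiction refl k≢x
... | tri≈ _ _ _    | there k∈zs = k∈zs
... | tri> _ _ _    | here refl  = here refl
... | tri> _ _ _    | there k∈zs = there (toggle-∈ k≢x k∈zs)

toggle-product : ∀ x zs .{{_ : NonZero x}} →
                 ∃ λ c → NonZero c × x * product zs ≡ product (toggle x zs) * (c * c)
toggle-product x []       = 1 , _ , sym (*-identityʳ (x * 1))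
toggle-product x (z ∷ zs) with <-cmp x z
... | tri< _ _ _    = 1 , _ , sym (*-identityʳ (x * (z * product zs)))
... | tri≈ _ refl _ = x , ≢-nonZero (≢-nonZero⁻¹ x) , cancel x (product zs)
  where
  cancel : ∀ x Z → x * (x * Z) ≡ Z * (x * x)
  cancel = solve-∀
... | tri> _ _ _ with toggle-product x zs
...   | c , c≢0 , eq = c , c≢0 , (begin
  x * (z * product zs)                  ≡⟨ swap x z (product zs) ⟩
  z * (x * product zs)                  ≡⟨ cong (z *_) eq ⟩
  z * (product (toggle x zs) * (c * c)) ≡⟨ sym (*-assoc z _ (c * c)) ⟩
  z * product (toggle x zs) * (c * c)   ∎)
  where
  open ≡-Reasoning
  swap : ∀ x z Z → x * (z * Z) ≡ z * (x * Z)
  swap = solve-∀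

△-All : ∀ {ℓ} {P : Pred ℕ ℓ} {xs ys} → All P xs → All P ys → All P (xs △ ys)
△-All []         pys = pys
△-All (px ∷ pxs) pys = toggle-All px (△-All pxs pys)

△-Linked : ∀ xs {ys} → Linked _<_ ys → Linked _<_ (xs △ ys)
△-Linked []       lnk = lnk
△-Linked (x ∷ xs) lnk = toggle-Linked (△-Linked xs lnk)

△-∈ : ∀ {k xs ys} → k ∈ ys → k ∉ xs → k ∈ xs △ ys
△-∈ {xs = []}     k∈ys _      = k∈ys
△-∈ {xs = x ∷ xs} k∈ys k∉x∷xs = toggle-∈ (k∉x∷xs ∘ here) (△-∈ k∈ys (k∉x∷xs ∘ there))

△-product : ∀ {xs} ys → All NonZero xs →
            ∃ λ c → NonZero c × product xs * product ys ≡ product (xs △ ys) * (c * c)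
△-product ys [] = 1 , _ , *-comm 1 (product ys)
△-product {x ∷ xs} ys (x≢0 ∷ nzs)
  with △-product ys nzs | toggle-product x (xs △ ys) {{x≢0}}
... | c , c≢0 , eq | d , d≢0 , eq′ = d * c , m*n≢0 d c {{d≢0}} {{c≢0}} , (begin
  x * product xs * product ys                      ≡⟨ *-assoc x _ _ ⟩
  x * (product xs * product ys)                    ≡⟨ cong (x *_) eq ⟩
  x * (product (xs △ ys) * (c * c))                ≡⟨ sym (*-assoc x _ _) ⟩
  x * product (xs △ ys) * (c * c)                  ≡⟨ cong (_* (c * c)) eq′ ⟩
  product (toggle x (xs △ ys)) * (d * d) * (c * c) ≡⟨ regroup (product (toggle x (xs △ ys))) d c ⟩
  product (toggle x (xs △ ys)) * (d * c * (d * c)) ∎)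
  where
  open ≡-Reasoning
  regroup : ∀ t d c → t * (d * d) * (c * c) ≡ t * (d * c * (d * c))
  regroup = solve-∀

-- Admissible n k is Chain (λ x → IsSquare (n * x)) 0 n k; the lower bound i on the terms after p
-- lets chain? decide by recursion on the candidates i, i + 1, …, k.
Chain : (ℕ → Set) → ℕ → ℕ → ℕ → Set
Chain P i p k = Σ (List ℕ) λ xs →
  Linked _<_ (p ∷ xs) × All (i ≤_) xs × last (p ∷ xs) ≡ just k × P (product xs)

chain-above : ∀ {P i p k} → k < i → Chain P i p k → p ≡ k × P 1
chain-above k<i ([] , _ , _ , refl , P1) = refl , P1
chain-above k<i (x ∷ xs , lnk , i≤x ∷ _ , eq , _) with last⇒All≤ lnk eq
... | _ ∷ x≤k ∷ _ = contradiction (≤-trans i≤x x≤k) (<⇒≱ k<i)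

chain-split : ∀ {P i p k} → Chain P i p k →
              (p ≡ k × P 1) ⊎ (p < i × Chain (λ x → P (i * x)) (suc i) i k) ⊎ Chain P (suc i) p k
chain-split ([] , _ , _ , refl , P1) = inj₁ (refl , P1)
chain-split {i = i} (x ∷ xs , p<x ∷ lnk , i≤x ∷ _ , eq , Pxs) with x ≟ i
... | yes refl = inj₂ (inj₁ (p<x , xs , lnk , Linked⇒All< lnk , eq , Pxs))
... | no x≢i   = inj₂ (inj₂ (x ∷ xs , p<x ∷ lnk , i<x ∷ All.map (<-trans i<x) (Linked⇒All< lnk) , eq , Pxs))
  where
  i<x : i < x
  i<x = ≤∧≢⇒< i≤x (x≢i ∘ sym)

chain-join : ∀ {P i p k} →
             (p ≡ k × P 1) ⊎ (p < i × Chain (λ x → P (i * x)) (suc i) i k) ⊎ Chain P (suc i) p k →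
             Chain P i p k
chain-join (inj₁ (refl , P1)) = [] , [-] , [] , refl , P1
chain-join {i = i} (inj₂ (inj₁ (p<i , xs , lnk , i<xs , eq , Pxs))) =
  i ∷ xs , p<i ∷ lnk , ≤-refl ∷ All.map <⇒≤ i<xs , eq , Pxs
chain-join (inj₂ (inj₂ (xs , lnk , i<xs , eq , Pxs))) = xs , lnk , All.map <⇒≤ i<xs , eq , Pxs

chain? : ∀ {P} → Decidable P → ∀ f i p k → k < f + i → Dec (Chain P i p k)
chain? {P} P? zero    i p k k<i = map′ (λ { (refl , P1) → [] , [-] , [] , refl , P1 })
                                       (chain-above {P} k<i) (p ≟ k ×-dec P? 1)
chain? {P} P? (suc f) i p k k<  = map′ (chain-join {P}) (chain-split {P})
  ((p ≟ k ×-dec P? 1) ⊎-dec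
   ((suc p ≤? i ×-dec chain? {λ x → P (i * x)} (P? ∘ (i *_)) f (suc i) i k k<′) ⊎-dec
    chain? {P} P? f (suc i) p k k<′))
  where
  k<′ : k < f + suc i
  k<′ = subst (k <_) (sym (+-suc f i)) k<

admissible? : ∀ n k → Dec (Admissible n k)
admissible? n k = map′ (λ (xs , lnk , _ , eq , sq) → xs , lnk , eq , sq)
                       (λ (xs , lnk , eq , sq) → xs , lnk , All.universal (λ _ → z≤n) xs , eq , sq)
                       (chain? (square? ∘ (n *_)) (suc k) 0 n k (s≤s (m≤m+n k 0)))

admissible⇒≤ : ∀ {n k} → Admissible n k → n ≤ k
admissible⇒≤ (_ , lnk , eq , _) = All.head (last⇒All≤ lnk eq)

admissible-square : ∀ {m} → IsSquare m → Admissible m m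
admissible-square {m} (r , r²≡m) = [] , [-] , refl , r , trans r²≡m (sym (*-identityʳ m))

admissible[n,4n] : ∀ n .{{_ : NonZero n}} → Admissible n (n * 4)
admissible[n,4n] n = n * 4 ∷ [] , m<m*n n 4 (s≤s (s≤s z≤n)) ∷ [-] , refl , n * 2 , square n
  where
  square : ∀ n → n * 2 * (n * 2) ≡ n * (n * 4 * 1)
  square = solve-∀

admissible[a,b,ab] : ∀ {a b} → 1 < a → a < b → Admissible a (a * b)
admissible[a,b,ab] {a} {b} 1<a a<b = b ∷ a * b ∷ [] , a<b ∷ b<ab ∷ [-] , refl , a * b , square a b
  where
  b<ab : b < a * b
  b<ab = subst (b <_) (*-comm b a) (m<m*n b a {{>-nonZero (<-trans (<-trans z<s 1<a) a<b)}} 1<a)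
  square : ∀ a b → a * b * (a * b) ≡ a * (b * (a * b * 1))
  square = solve-∀

admissible⇒¬prime : ∀ {n k} .{{_ : NonZero n}} → Admissible n k → ¬ Prime k
admissible⇒¬prime {n} {k} (xs , lnk , eq , sq) pk with product-last lnk eq
... | ys , bounds , prod≡ =
  ¬square[m*p] pk (prime∤product pk (All.map positive bounds)) (subst IsSquare prod≡ sq)
  where
  positive : ∀ {y} → n ≤ y × y < k → 0 < y × y < k
  positive (n≤y , y<k) = <-≤-trans (>-nonZero⁻¹ n) n≤y , y<k

admissible-from : ∀ {n m zs} → Linked _<_ zs → All (n <_) zs → m ∈ zs → All (_≤ m) zs →
                  IsSquare (product zs) → ∃ λ n′ → n < n′ × Admissible n′ m
admissible-from {zs = z ∷ zs} lnk (n<z ∷ _) m∈ ≤m sq = z , n<z , zs , lnk , maximum⇒last lnk m∈ ≤m , sq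

admissible-shift : ∀ {n j m} .{{_ : NonZero n}} → j < m → Admissible n j → Admissible n m →
                   ∃ λ n′ → n < n′ × Admissible n′ m
admissible-shift {n} {j} {m} j<m (xs , lxs , eqx , r , r²) (ys , lys , eqy , s , s²) =
  admissible-from (△-Linked xs (Linked.tail lys)) (△-All (Linked⇒All< lxs) (Linked⇒All< lys))
                  (△-∈ m∈ys m∉xs) (△-All xs≤m (All.tail (last⇒All≤ lys eqy)))
                  (△-square (△-product ys xs≢0))
  where
  xs≢0 : All NonZero xs
  xs≢0 = All.map (λ n<x → >-nonZero (<-trans (>-nonZero⁻¹ n) n<x)) (Linked⇒All< lxs)
  xs≤j : All (_≤ j) xs
  xs≤j = All.tail (last⇒All≤ lxs eqx)
  xs≤m : All (_≤ m) xs
  xs≤m = All.map (λ x≤j → <⇒≤ (≤-<-trans x≤j j<m)) xs≤j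
  m∉xs : m ∉ xs
  m∉xs m∈xs = <⇒≱ j<m (All.lookup xs≤j m∈xs)
  m∈ys : m ∈ ys
  m∈ys = Any.tail (λ m≡n → <⇒≢ (≤-<-trans (All.head (last⇒All≤ lxs eqx)) j<m) (sym m≡n)) (last⇒∈ eqy)
  △-square : (∃ λ c → NonZero c × product xs * product ys ≡ product (xs △ ys) * (c * c)) →
             IsSquare (product (xs △ ys))
  △-square (c , c≢0 , eq) = square-cancel {r = r * s} {{m*n≢0 n c {{it}} {{c≢0}}}} (begin
    product (xs △ ys) * (n * c * (n * c))     ≡⟨ regroup (product (xs △ ys)) n c ⟩
    n * n * (product (xs △ ys) * (c * c))     ≡⟨ cong (n * n *_) (sym eq) ⟩
    n * n * (product xs * product ys)         ≡⟨ [m*n]*[o*p]≡[m*o]*[n*p] n n _ _ ⟩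
    n * product xs * (n * product ys)         ≡⟨ cong₂ _*_ (sym r²) (sym s²) ⟩
    r * r * (s * s)                           ≡⟨ [m*n]*[o*p]≡[m*o]*[n*p] r r s s ⟩
    r * s * (r * s)                           ∎)
    where
    open ≡-Reasoning
    regroup : ∀ z n c → z * (n * c * (n * c)) ≡ n * n * (z * (c * c))
    regroup = solve-∀

maximal⇒IsG : ∀ {n m} .{{_ : NonZero n}} → Admissible n m → (∀ j → Admissible j m → j ≤ n) → IsG n m
maximal⇒IsG adm maximal = adm , λ j adm-j → ≮⇒≥ λ j<m →
  let n′ , n<n′ , adm′ = admissible-shift j<m adm-j adm in <⇒≱ n<n′ (maximal n′ adm′)

nonprime⇒admissible-from-positive : ∀ m .{{_ : NonZero m}} → ¬ Prime m →
                                     ∃ λ n → NonZero n × Admissible n m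
nonprime⇒admissible-from-positive 1 _ = 1 , _ , admissible-square (1 , refl)
nonprime⇒admissible-from-positive m@(suc (suc _)) ¬pm with ¬prime⇒composite ¬pm
... | composite {d} d<m (divides q m≡qd) with <-cmp q d
...   | tri< q<d _ _ = q , >-nonZero (<-trans z<s 1<q) ,
                       subst (Admissible q) (sym m≡qd) (admissible[a,b,ab] 1<q q<d)
  where
  1<q : 1 < q
  1<q = *-cancelʳ-< d 1 q (subst₂ _<_ (sym (*-identityˡ d)) m≡qd d<m)
...   | tri≈ _ refl _ = m , _ , admissible-square (q , sym m≡qd)
...   | tri> _ _ d<q = d , >-nonZero (<-trans z<s 1<d) ,
                       subst (Admissible d) (sym (trans m≡qd (*-comm q d))) (admissible[a,b,ab] 1<d d<q)
  where
  1<d : 1 < d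
  1<d = nonTrivial⇒n>1 d

g-defined-and-not-prime : ∀ n → ∃ λ k → IsG n k × ¬ Prime k
g-defined-and-not-prime zero = 0 , (admissible-square (0 , refl) , λ _ _ → z≤n) , ¬prime[0]
g-defined-and-not-prime n@(suc _) with least (admissible? n) (admissible[n,4n] n)
... | k , adm , minimal = k , (adm , minimal) , admissible⇒¬prime adm

nonprime⇒in-image-of-g : ∀ m → ¬ Prime m → ∃ λ n → IsG n m
nonprime⇒in-image-of-g zero _ = 0 , admissible-square (0 , refl) , λ _ _ → z≤n
nonprime⇒in-image-of-g m@(suc _) ¬pm with nonprime⇒admissible-from-positive m ¬pm
... | n₀ , n₀≢0 , adm₀ with greatest (λ j → admissible? j m) m (λ _ → admissible⇒≤) adm₀
...   | n , adm , maximal = n , maximal⇒IsG {{n≢0}} adm maximal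
  where
  n≢0 : NonZero n
  n≢0 = >-nonZero (<-≤-trans (>-nonZero⁻¹ n₀ {{n₀≢0}}) (maximal n₀ adm₀))

theorem1p13 : (∀ n → ∃ λ k → IsG n k × ¬ Prime k)
              × (∀ m → ¬ Prime m → ∃ λ n → IsG n m)
theorem1p13 = g-defined-and-not-prime , nonprime⇒in-image-of-g
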